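{- Let $G$ be a finite graph that is both a cograph and a C-I graph. Then there exist completely ranked posets $P_1,\ldots,P_r$, each of rank at most $2$, such that $G\cong G_P$ for the poset $P=P_1+P_2+\cdots+P_r$.
   Context: A cograph is a graph with no induced path on four vertices. For a finite poset $P=(V,\le)$, write $u\lhd v$ if $u<v$ and no $w$ satisfies $u<w<v$, and $u\,\|\,v$ if $u,v$ are incomparable. The C-I graph $G_P$ has vertex set $V$ with $uv$ an edge iff $u\lhd v$, $v\lhd u$, or $u\,\|\,v$; a graph is a C-I graph if it is isomorphic to some $G_P$. A ranked poset is a poset with a function $\rho:V\to\mathbb{Z}$ taking value $0$ on all minimal elements and satisfying $\rho(b)=\rho(a)+1$ whenever $a\lhd b$; its rank is the maximum value of $\rho$. It is completely ranked if every element of rank $i$ covers all elements of rank $i-1$, for every $i$. For disjoint posets $P_1=(V_1,\le)$, $P_2=(V_2,\le)$, the sum $P_1+P_2$ is the poset on $V_1\cup V_2$ in which $z_1\le z_2$ iff $z_1\le z_2$ in $P_1$ or in $P_2$ (elements from different summands are incomparable). -}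

module Defs where

open import Data.Nat using (ℕ)
open import Data.Fin using (Fin)
open import Data.Integer using (ℤ; +_; _+_; _≤_)
open import Data.Product using (Σ; _×_; _,_)
open import Data.Sum using (_⊎_)
open import Data.Empty using (⊥)
open import Relation.Nullary using (¬_)
open import Relation.Binary.Definitions using (Decidable)
open import Relation.Binary.Structures using (IsPartialOrder)
open import Relation.Binary.PropositionalEquality using (_≡_; _≢_)
open import Function.Bundles using (_⤖_; _⇔_; Bijection)

record SimpleGraph (n : ℕ) : Set₁ where
  field
    Adj    : Fin n → Fin n → Set
    sym    : ∀ {u v} → Adj u v → Adj v u
    irrefl : ∀ {u} → ¬ Adj u u

-- G is a cograph: no induced path a - b - c - d on four vertices.
-- (The four vertices are automatically distinct given the adjacency /
-- non-adjacency conditions and irreflexivity.)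
IsCograph : ∀ {n} → SimpleGraph n → Set
IsCograph {n} G = (a b c d : Fin n) →
  Adj a b → Adj b c → Adj c d →
  ¬ Adj a c → ¬ Adj b d → ¬ Adj a d → ⊥
  where open SimpleGraph G

_≅_ : ∀ {n} {V : Set} → SimpleGraph n → (V → V → Set) → Set
_≅_ {n} {V} G E = Σ (Fin n ⤖ V) λ f →
  (u v : Fin n) → SimpleGraph.Adj G u v ⇔ E (Bijection.to f u) (Bijection.to f v)

module _ {V : Set} (_≼_ : V → V → Set) where

  Strict : V → V → Set
  Strict a b = (a ≼ b) × (a ≢ b)

  Covers : V → V → Set
  Covers a b = Strict a b × ((w : V) → ¬ (Strict a w × Strict w b))

  Incomparable : V → V → Set
  Incomparable a b = ¬ (a ≼ b) × ¬ (b ≼ a)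

  CIEdge : V → V → Set
  CIEdge u v = Covers u v ⊎ Covers v u ⊎ Incomparable u v

  Minimal : V → Set
  Minimal a = (b : V) → b ≼ a → b ≡ a

  IsRankFunction : (V → ℤ) → Set
  IsRankFunction ρ =
    ((a : V) → Minimal a → ρ a ≡ + 0) ×
    ((a b : V) → Covers a b → ρ b ≡ ρ a + + 1)

  CompletelyRankedRankAtMost2 : Set
  CompletelyRankedRankAtMost2 = Σ (V → ℤ) λ ρ →
    IsRankFunction ρ ×
    ((a b : V) → ρ b ≡ ρ a + + 1 → Covers a b) ×
    ((a : V) → ρ a ≤ + 2)

-- Finite posets on Fin m (order decidable, as any finite poset is)

record FinPoset (m : ℕ) : Set₁ where
  field
    _≼_   : Fin m → Fin m → Set
    dec   : Decidable _≼_
    isPO  : IsPartialOrder _≡_ _≼_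

IsCIGraph : ∀ {n} → SimpleGraph n → Set₁
IsCIGraph G = Σ ℕ λ m → Σ (FinPoset m) λ P → G ≅ CIEdge (FinPoset._≼_ P)

-- The sum P_1 + ... + P_r of a family of finite posets, on the disjoint
-- union Σ (Fin r) (λ i → Fin (s i)); elements of different summands are
-- incomparable.
data SumLe {r : ℕ} (s : Fin r → ℕ) (P : (i : Fin r) → FinPoset (s i))
     : Σ (Fin r) (λ i → Fin (s i)) → Σ (Fin r) (λ i → Fin (s i)) → Set where
  inSummand : ∀ {i x y} → FinPoset._≼_ (P i) x y → SumLe s P (i , x) (i , y)

-- In any finite poset P, two distinct elements are non-adjacent in G_P exactly when they are
-- "far": x < w < y for some w. So G_P is determined by the Far relation, and it suffices to
-- build a sum of completely ranked posets of rank ≤ 2 with the same Far relation.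
-- If G_P is a cograph, refining a chain into covers shows that P has no chain of four
-- elements, and a second induced-P4 argument shows that the graph of far pairs is a disjoint
-- union of complete bipartite graphs between "bottoms" and "tops". Group each component
-- with the elements lying between its bottoms and tops, and put bottoms and isolated
-- elements on level 0, elements strictly between two others on level 1, and tops on
-- level 2. Ordering each group by level gives the required sum: its far pairs are exactly
-- the level-0/level-2 pairs of a group, which are exactly the far pairs of P.

module Submission where

open import Defs
open import Data.Nat as ℕ using (ℕ; zero; suc; z≤n; s≤s)
import Data.Nat.Properties as ℕₚ
open import Data.Integer as ℤ using (ℤ)
import Data.Integer.Properties as ℤₚ
open import Data.Fin using (Fin; zero; suc; _≟_)
open import Data.Fin.Properties using (any?; +↔⊎)
open import Data.Fin.Induction using (po-wellFounded)
open import Data.Maybe as Maybe using (Maybe; just; nothing)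
open import Data.Maybe.Properties using (just-injective)
open import Data.Product using (Σ; ∃; ∃₂; _×_; _,_; proj₁; proj₂)
open import Data.Sum using (_⊎_; inj₁; inj₂)
open import Data.Sum.Function.Propositional using (_⊎-↔_)
open import Data.Empty using (⊥; ⊥-elim)
open import Relation.Nullary using (¬_; Dec; yes; no; Irrelevant)
open import Relation.Nullary.Decidable using (_×-dec_; _⊎-dec_; ¬?)
open import Relation.Unary using () renaming (Decidable to Decidable₁)
open import Relation.Binary.Bundles using (Poset)
open import Relation.Binary.Definitions using (Decidable)
open import Relation.Binary.Structures using (IsPartialOrder; IsEquivalence)
open import Relation.Binary.PropositionalEquality
  using (_≡_; _≢_; refl; sym; trans; cong; subst; subst₂; isEquivalence; module ≡-Reasoning)
import Relation.Binary.Properties.Poset as PosetProperties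
open import Function.Base using (_∘_)
open import Function.Bundles
  using (_⤖_; Bijection; _⇔_; _↔_; Inverse; Equivalence; mk⇔; mk↔ₛ′)
open import Function.Construct.Composition using (_⤖-∘_; _⇔-∘_; _↔-∘_)
open import Function.Properties.Inverse using (↔-sym; ↔⇒⤖)
open import Function.Properties.Bijection using (⤖⇒↔)
open import Induction.WellFounded using (Acc; acc)
open import Axiom.UniquenessOfIdentityProofs using (module Decidable⇒UIP)

InducedP4Free : {V : Set} → (V → V → Set) → Set
InducedP4Free {V} E = (a b c d : V) →
  E a b → E b c → E c d → ¬ E a c → ¬ E b d → ¬ E a d → ⊥

module _ {V W : Set} {E : V → V → Set} {F : W → W → Set} where

  inducedP4Free-transport : (f : V ↔ W) →
    (∀ u v → E u v ⇔ F (Inverse.to f u) (Inverse.to f v)) →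
    InducedP4Free E → InducedP4Free F
  inducedP4Free-transport f E⇔F p4free a b c d ab bc cd ¬ac ¬bd ¬ad =
    p4free (from a) (from b) (from c) (from d)
      (pull ab) (pull bc) (pull cd) (¬ac ∘ push) (¬bd ∘ push) (¬ad ∘ push)
    where
    open Inverse f using (from; strictlyInverseˡ)
    pull : ∀ {x y} → F x y → E (from x) (from y)
    pull {x} {y} fxy = Equivalence.from (E⇔F (from x) (from y))
      (subst₂ F (sym (strictlyInverseˡ x)) (sym (strictlyInverseˡ y)) fxy)
    push : ∀ {x y} → E (from x) (from y) → F x y
    push {x} {y} exy = subst₂ F (strictlyInverseˡ x) (strictlyInverseˡ y)
      (Equivalence.to (E⇔F (from x) (from y)) exy)

  ≅-transport : ∀ {n} {G : SimpleGraph n} → G ≅ E → (f : V ⤖ W) →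
    (∀ u v → E u v ⇔ F (Bijection.to f u) (Bijection.to f v)) → G ≅ F
  ≅-transport (φ , G⇔E) f E⇔F = f ⤖-∘ φ , λ u v → E⇔F _ _ ⇔-∘ G⇔E u v

module OrderIsomorphism {A B : Set} (_≤₁_ : A → A → Set) (_≤₂_ : B → B → Set) (f : A ↔ B)
  (≤⇔ : ∀ {x y} → x ≤₁ y ⇔ Inverse.to f x ≤₂ Inverse.to f y) where

  open Inverse f using (to; from; strictlyInverseˡ; strictlyInverseʳ)

  to-injective : ∀ {x y} → to x ≡ to y → x ≡ y
  to-injective {x} {y} eq =
    trans (sym (strictlyInverseʳ x)) (trans (cong from eq) (strictlyInverseʳ y))

  Strict⇔ : ∀ {x y} → Strict _≤₁_ x y ⇔ Strict _≤₂_ (to x) (to y)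
  Strict⇔ = mk⇔ (λ (x≤y , x≢y) → Equivalence.to ≤⇔ x≤y , x≢y ∘ to-injective)
                (λ (x≤y , x≢y) → Equivalence.from ≤⇔ x≤y , x≢y ∘ cong to)

  Covers⇔ : ∀ {x y} → Covers _≤₁_ x y ⇔ Covers _≤₂_ (to x) (to y)
  Covers⇔ {x} {y} = mk⇔
    (λ (x<y , nothing-between) → Equivalence.to Strict⇔ x<y , λ w (x<w , w<y) →
      nothing-between (from w)
        ( Equivalence.from Strict⇔ (subst (Strict _≤₂_ (to x)) (sym (strictlyInverseˡ w)) x<w)
        , Equivalence.from Strict⇔
            (subst (λ v → Strict _≤₂_ v (to y)) (sym (strictlyInverseˡ w)) w<y)))
    (λ (x<y , nothing-between) → Equivalence.from Strict⇔ x<y , λ w (x<w , w<y) →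
      nothing-between (to w) (Equivalence.to Strict⇔ x<w , Equivalence.to Strict⇔ w<y))

  CIEdge⇔ : ∀ {x y} → CIEdge _≤₁_ x y ⇔ CIEdge _≤₂_ (to x) (to y)
  CIEdge⇔ = mk⇔
    (λ where (inj₁ x⊲y) → inj₁ (Equivalence.to Covers⇔ x⊲y)
             (inj₂ (inj₁ y⊲x)) → inj₂ (inj₁ (Equivalence.to Covers⇔ y⊲x))
             (inj₂ (inj₂ (x≰y , y≰x))) →
               inj₂ (inj₂ (x≰y ∘ Equivalence.from ≤⇔ , y≰x ∘ Equivalence.from ≤⇔)))
    (λ where (inj₁ x⊲y) → inj₁ (Equivalence.from Covers⇔ x⊲y)
             (inj₂ (inj₁ y⊲x)) → inj₂ (inj₁ (Equivalence.from Covers⇔ y⊲x))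
             (inj₂ (inj₂ (x≰y , y≰x))) →
               inj₂ (inj₂ (x≰y ∘ Equivalence.to ≤⇔ , y≰x ∘ Equivalence.to ≤⇔)))

module FinitePoset {m : ℕ} {_≼_ : Fin m → Fin m → Set}
                   (_≼?_ : Decidable _≼_) (isPO : IsPartialOrder _≡_ _≼_) where

  ≼-poset : Poset _ _ _
  ≼-poset = record { isPartialOrder = isPO }

  open Poset ≼-poset public using ()
    renaming (refl to ≼-refl; trans to ≼-trans; antisym to ≼-antisym)
  open PosetProperties ≼-poset public using (_<_; <-trans; <-asym)

  _<?_ : Decidable _<_
  x <? y = (x ≼? y) ×-dec ¬? (x ≟ y)

  ≼⇒≡⊎< : ∀ {x y} → x ≼ y → x ≡ y ⊎ x < y
  ≼⇒≡⊎< {x} {y} x≼y with x ≟ y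
  ... | yes x≡y = inj₁ x≡y
  ... | no x≢y = inj₂ (x≼y , x≢y)

  ≼-<-trans : ∀ {x y z} → x ≼ y → y < z → x < z
  ≼-<-trans x≼y (y≼z , y≢z) = ≼-trans x≼y y≼z , λ { refl → y≢z (≼-antisym y≼z x≼y) }

  Far : Fin m → Fin m → Set
  Far x y = ∃ λ w → x < w × w < y

  far? : Decidable Far
  far? x y = any? (λ w → (x <? w) ×-dec (w <? y))

  Far⇒< : ∀ {x y} → Far x y → x < y
  Far⇒< (_ , x<w , w<y) = <-trans x<w w<y

  <∧¬Far⇒Covers : ∀ {x y} → x < y → ¬ Far x y → Covers _≼_ x y
  <∧¬Far⇒Covers x<y ¬far = x<y , λ w between → ¬far (w , between)

  CIEdge-sym : ∀ {x y} → CIEdge _≼_ x y → CIEdge _≼_ y x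
  CIEdge-sym (inj₁ x⊲y) = inj₂ (inj₁ x⊲y)
  CIEdge-sym (inj₂ (inj₁ y⊲x)) = inj₁ y⊲x
  CIEdge-sym (inj₂ (inj₂ (x⋠y , y⋠x))) = inj₂ (inj₂ (y⋠x , x⋠y))

  CIEdge⇒¬Far : ∀ {x y} → CIEdge _≼_ x y → ¬ Far x y
  CIEdge⇒¬Far (inj₁ (_ , nothing-between)) (w , between) = nothing-between w between
  CIEdge⇒¬Far (inj₂ (inj₁ (y<x , _))) far = <-asym (Far⇒< far) y<x
  CIEdge⇒¬Far (inj₂ (inj₂ (x⋠y , _))) far = x⋠y (proj₁ (Far⇒< far))

  Far⇒¬CIEdge : ∀ {x y} → Far x y → ¬ CIEdge _≼_ x y
  Far⇒¬CIEdge far e = CIEdge⇒¬Far e far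

  Far⇒¬CIEdge-flip : ∀ {x y} → Far y x → ¬ CIEdge _≼_ x y
  Far⇒¬CIEdge-flip far e = CIEdge⇒¬Far (CIEdge-sym e) far

  CIEdge⇒≢ : ∀ {x y} → CIEdge _≼_ x y → x ≢ y
  CIEdge⇒≢ (inj₁ ((_ , x≢y) , _)) = x≢y
  CIEdge⇒≢ (inj₂ (inj₁ ((_ , y≢x) , _))) = y≢x ∘ sym
  CIEdge⇒≢ (inj₂ (inj₂ (x⋠y , _))) refl = x⋠y ≼-refl

  ¬Far⇒CIEdge : ∀ {x y} → x ≢ y → ¬ Far x y → ¬ Far y x → CIEdge _≼_ x y
  ¬Far⇒CIEdge {x} {y} x≢y ¬far ¬far′ with x ≼? y | y ≼? x
  ... | yes x≼y | _ = inj₁ (<∧¬Far⇒Covers (x≼y , x≢y) ¬far)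
  ... | no _ | yes y≼x = inj₂ (inj₁ (<∧¬Far⇒Covers (y≼x , x≢y ∘ sym) ¬far′))
  ... | no x⋠y | no y⋠x = inj₂ (inj₂ (x⋠y , y⋠x))

  CIEdge⇔≢∧¬Far : ∀ {x y} → CIEdge _≼_ x y ⇔ (x ≢ y × ¬ Far x y × ¬ Far y x)
  CIEdge⇔≢∧¬Far = mk⇔
    (λ e → CIEdge⇒≢ e , CIEdge⇒¬Far e , CIEdge⇒¬Far (CIEdge-sym e))
    (λ (x≢y , ¬far , ¬far′) → ¬Far⇒CIEdge x≢y ¬far ¬far′)

  covered-below : ∀ {x y} → x < y → ∃ λ w → Covers _≼_ x w × w ≼ y
  covered-below {x} {y} = go (po-wellFounded isPO y)
    where
    go : ∀ {y} → Acc _<_ y → x < y → ∃ λ w → Covers _≼_ x w × w ≼ y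
    go {y} (acc below) x<y with far? x y
    ... | no ¬far = y , <∧¬Far⇒Covers x<y ¬far , ≼-refl
    ... | yes (w , x<w , w<y) with go (below w<y) x<w
    ...   | v , x⊲v , v≼w = v , x⊲v , ≼-trans v≼w (proj₁ w<y)

CIEdge⇔-from-Far⇔ : ∀ {m} {_≼₁_ _≼₂_ : Fin m → Fin m → Set}
  (dec₁ : Decidable _≼₁_) (po₁ : IsPartialOrder _≡_ _≼₁_)
  (dec₂ : Decidable _≼₂_) (po₂ : IsPartialOrder _≡_ _≼₂_) →
  (∀ {x y} → FinitePoset.Far dec₁ po₁ x y ⇔ FinitePoset.Far dec₂ po₂ x y) →
  ∀ {x y} → CIEdge _≼₁_ x y ⇔ CIEdge _≼₂_ x y
CIEdge⇔-from-Far⇔ dec₁ po₁ dec₂ po₂ Far⇔ = mk⇔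
  (λ e → let (x≢y , ¬far , ¬far′) = Equivalence.to P₁.CIEdge⇔≢∧¬Far e
         in Equivalence.from P₂.CIEdge⇔≢∧¬Far
              (x≢y , ¬far ∘ Equivalence.from Far⇔ , ¬far′ ∘ Equivalence.from Far⇔))
  (λ e → let (x≢y , ¬far , ¬far′) = Equivalence.to P₂.CIEdge⇔≢∧¬Far e
         in Equivalence.from P₁.CIEdge⇔≢∧¬Far
              (x≢y , ¬far ∘ Equivalence.to Far⇔ , ¬far′ ∘ Equivalence.to Far⇔))
  where
  module P₁ = FinitePoset dec₁ po₁
  module P₂ = FinitePoset dec₂ po₂

first : ∀ {n} {P : Fin n → Set} → Decidable₁ P → Maybe (Fin n)
first {zero} P? = nothing
first {suc n} P? with P? zero
... | yes _ = just zero
... | no _ = Maybe.map suc (first (P? ∘ suc))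

first-cong : ∀ {n} {P Q : Fin n → Set} (P? : Decidable₁ P) (Q? : Decidable₁ Q) →
  (∀ i → P i → Q i) → (∀ i → Q i → P i) → first P? ≡ first Q?
first-cong {zero} P? Q? P⇒Q Q⇒P = refl
first-cong {suc n} P? Q? P⇒Q Q⇒P with P? zero | Q? zero
... | yes _ | yes _ = refl
... | yes p | no ¬q = ⊥-elim (¬q (P⇒Q zero p))
... | no ¬p | yes q = ⊥-elim (¬p (Q⇒P zero q))
... | no _ | no _ = cong (Maybe.map suc)
  (first-cong (P? ∘ suc) (Q? ∘ suc) (P⇒Q ∘ suc) (Q⇒P ∘ suc))

first-found : ∀ {n} {P : Fin n → Set} (P? : Decidable₁ P) {i : Fin n} → P i →
  ∃ λ j → first P? ≡ just j × P j
first-found {suc n} P? {i} pᵢ with P? zero | i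
... | yes p₀ | _ = zero , refl , p₀
... | no ¬p₀ | zero = ⊥-elim (¬p₀ pᵢ)
... | no _ | suc i′ with first-found (P? ∘ suc) pᵢ
...   | j , found , pⱼ = suc j , cong (Maybe.map suc) found , pⱼ

Σ-Fin-suc↔ : ∀ {n} {P : Fin (suc n) → Set} →
  Σ (Fin (suc n)) P ↔ (P zero ⊎ Σ (Fin n) (P ∘ suc))
Σ-Fin-suc↔ = mk↔ₛ′ split join split-join join-split
  where
  split : Σ (Fin (suc _)) _ → _ ⊎ Σ (Fin _) _
  split (zero , p) = inj₁ p
  split (suc i , p) = inj₂ (i , p)
  join : _ ⊎ Σ (Fin _) _ → Σ (Fin (suc _)) _
  join (inj₁ p) = zero , p
  join (inj₂ (i , p)) = suc i , p
  split-join : ∀ q → split (join q) ≡ q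
  split-join (inj₁ _) = refl
  split-join (inj₂ _) = refl
  join-split : ∀ q → join (split q) ≡ q
  join-split (zero , _) = refl
  join-split (suc _ , _) = refl

irrelevant↔Fin : ∀ {A : Set} → Dec A → Irrelevant A → ∃ λ s → A ↔ Fin s
irrelevant↔Fin (yes a) irr = 1 , mk↔ₛ′ (λ _ → zero) (λ _ → a) (λ { zero → refl }) (irr a)
irrelevant↔Fin (no ¬a) _ = 0 , mk↔ₛ′ (⊥-elim ∘ ¬a) (λ ()) (λ ()) (λ a → ⊥-elim (¬a a))

Σ-Fin↔Fin : ∀ {n} {P : Fin n → Set} → Decidable₁ P → (∀ {i} → Irrelevant (P i)) →
  ∃ λ s → Σ (Fin n) P ↔ Fin s
Σ-Fin↔Fin {zero} _ _ = 0 , mk↔ₛ′ (λ ()) (λ ()) (λ ()) (λ ())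
Σ-Fin↔Fin {suc n} P? irr with irrelevant↔Fin (P? zero) irr | Σ-Fin↔Fin (P? ∘ suc) irr
... | s₀ , P₀↔ | s , P₊↔ = s₀ ℕ.+ s , (↔-sym +↔⊎ ↔-∘ (P₀↔ ⊎-↔ P₊↔)) ↔-∘ Σ-Fin-suc↔

module CanonicalRepresentative {m : ℕ} {_∼_ : Fin m → Fin m → Set}
         (isEquivalence : IsEquivalence _∼_) (_∼?_ : Decidable _∼_) where

  open IsEquivalence isEquivalence renaming (refl to ∼-refl; sym to ∼-sym; trans to ∼-trans)

  private
    least : ∀ x → ∃ λ r → first (x ∼?_) ≡ just r × x ∼ r
    least x = first-found (x ∼?_) ∼-refl

  rep : Fin m → Fin m
  rep x = proj₁ (least x)

  rep-≡⇔∼ : ∀ {x y} → rep x ≡ rep y ⇔ x ∼ y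
  rep-≡⇔∼ {x} {y} = mk⇔
    (λ same → ∼-trans (proj₂ (proj₂ (least x)))
                (∼-sym (subst (y ∼_) (sym same) (proj₂ (proj₂ (least y))))))
    (λ x∼y → just-injective (begin
      just (rep x)    ≡⟨ sym (proj₁ (proj₂ (least x))) ⟩
      first (x ∼?_)   ≡⟨ first-cong (x ∼?_) (y ∼?_)
                            (λ _ → ∼-trans (∼-sym x∼y)) (λ _ → ∼-trans x∼y) ⟩
      first (y ∼?_)   ≡⟨ proj₁ (proj₂ (least y)) ⟩
      just (rep y)    ∎))
    where open ≡-Reasoning

module CographPoset {m : ℕ} {_≼_ : Fin m → Fin m → Set}
                    (_≼?_ : Decidable _≼_) (isPO : IsPartialOrder _≡_ _≼_)
                    (p4free : InducedP4Free (CIEdge _≼_)) where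

  open FinitePoset _≼?_ isPO

  -- Refining a chain a < b < c < d to covers a ⊲ x₁ ⊲ x₂ ⊲ x₃ yields an induced P4.
  no-chain4 : ∀ {a b c d} → a < b → b < c → c < d → ⊥
  no-chain4 {a} a<b b<c c<d with covered-below a<b
  ... | x₁ , a⊲x₁ , x₁≼b with covered-below (≼-<-trans x₁≼b b<c)
  ... | x₂ , x₁⊲x₂ , x₂≼c with covered-below (≼-<-trans x₂≼c c<d)
  ... | x₃ , x₂⊲x₃ , _ =
    p4free a x₁ x₂ x₃ (inj₁ a⊲x₁) (inj₁ x₁⊲x₂) (inj₁ x₂⊲x₃)
      (Far⇒¬CIEdge (x₁ , proj₁ a⊲x₁ , proj₁ x₁⊲x₂))
      (Far⇒¬CIEdge (x₂ , proj₁ x₁⊲x₂ , proj₁ x₂⊲x₃))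
      (Far⇒¬CIEdge (x₁ , proj₁ a⊲x₁ , <-trans (proj₁ x₁⊲x₂) (proj₁ x₂⊲x₃)))

  Bottom Top Middle : Fin m → Set
  Bottom x = ∃ λ t → Far x t
  Top x = ∃ λ b → Far b x
  Middle x = ∃₂ λ b t → b < x × x < t

  top? : ∀ x → Dec (Top x)
  top? x = any? (λ b → far? b x)

  middle? : ∀ x → Dec (Middle x)
  middle? x = any? (λ b → any? (λ t → (b <? x) ×-dec (x <? t)))

  bottom-top-disjoint : ∀ {x} → Bottom x → ¬ Top x
  bottom-top-disjoint (_ , _ , x<w , _) (_ , _ , b<v , v<x) = no-chain4 b<v v<x x<w

  bottom-middle-disjoint : ∀ {x} → Bottom x → ¬ Middle x
  bottom-middle-disjoint (_ , _ , x<w , w<t) (_ , _ , b<x , _) = no-chain4 b<x x<w w<t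

  top-middle-disjoint : ∀ {x} → Top x → ¬ Middle x
  top-middle-disjoint (_ , _ , b<v , v<x) (_ , _ , _ , x<t) = no-chain4 b<v v<x x<t

  ¬Far-from-top : ∀ {x y} → Top x → ¬ Far x y
  ¬Far-from-top t far = bottom-top-disjoint (_ , far) t

  ¬Far-to-bottom : ∀ {x y} → Bottom y → ¬ Far x y
  ¬Far-to-bottom bot far = bottom-top-disjoint bot (_ , far)

  -- Otherwise t — t′ — b — b′ is an induced P4 of G_P.
  far-bipartite : ∀ {b t b′ t′} → Far b t → Far b′ t → Far b′ t′ → Far b t′
  far-bipartite {b} {t} {b′} {t′} bt b′t b′t′ with far? b t′
  ... | yes bt′ = bt′
  ... | no ¬bt′ = ⊥-elim (p4free t t′ b b′ tt′ t′b bb′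
      (Far⇒¬CIEdge-flip bt) (Far⇒¬CIEdge-flip b′t′) (Far⇒¬CIEdge-flip b′t))
    where
    tt′ : CIEdge _≼_ t t′
    tt′ = ¬Far⇒CIEdge (λ { refl → ¬bt′ bt })
      (¬Far-from-top (_ , bt)) (¬Far-from-top (_ , b′t′))
    t′b : CIEdge _≼_ t′ b
    t′b = ¬Far⇒CIEdge (λ { refl → bottom-top-disjoint (_ , bt) (_ , b′t′) })
      (¬Far-to-bottom (_ , bt)) ¬bt′
    bb′ : CIEdge _≼_ b b′
    bb′ = ¬Far⇒CIEdge (λ { refl → ¬bt′ b′t′ })
      (¬Far-to-bottom (_ , b′t)) (¬Far-to-bottom (_ , bt))

  Spans : Fin m → Fin m → Fin m → Set
  Spans b t x = Far b t × b ≼ x × x ≼ t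

  spans? : ∀ b t x → Dec (Spans b t x)
  spans? b t x = far? b t ×-dec (b ≼? x) ×-dec (x ≼? t)

  spans-start : ∀ {b t} → Far b t → Spans b t b
  spans-start far = far , ≼-refl , proj₁ (Far⇒< far)

  spans-end : ∀ {b t} → Far b t → Spans b t t
  spans-end far = far , proj₁ (Far⇒< far) , ≼-refl

  spans-bottom⇒≡ : ∀ {b t x} → Spans b t x → Bottom x → x ≡ b
  spans-bottom⇒≡ (_ , b≼x , _) (_ , _ , x<w , w<u) with ≼⇒≡⊎< b≼x
  ... | inj₁ b≡x = sym b≡x
  ... | inj₂ b<x = ⊥-elim (no-chain4 b<x x<w w<u)

  spans-top⇒≡ : ∀ {b t x} → Spans b t x → Top x → x ≡ t
  spans-top⇒≡ (_ , _ , x≼t) (_ , _ , v<w , w<x) with ≼⇒≡⊎< x≼t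
  ... | inj₁ x≡t = x≡t
  ... | inj₂ x<t = ⊥-elim (no-chain4 v<w w<x x<t)

  spans-middle⇒< : ∀ {b t x} → Spans b t x → Middle x → b < x × x < t
  spans-middle⇒< (bt , b≼x , x≼t) mid with ≼⇒≡⊎< b≼x | ≼⇒≡⊎< x≼t
  ... | inj₁ refl | _ = ⊥-elim (bottom-middle-disjoint (_ , bt) mid)
  ... | inj₂ _ | inj₁ refl = ⊥-elim (top-middle-disjoint (_ , bt) mid)
  ... | inj₂ b<x | inj₂ x<t = b<x , x<t

  spans-classify : ∀ {b t x} → Spans b t x → Bottom x ⊎ Top x ⊎ Middle x
  spans-classify (bt , b≼x , x≼t) with ≼⇒≡⊎< b≼x | ≼⇒≡⊎< x≼t
  ... | inj₁ refl | _ = inj₁ (_ , bt)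
  ... | inj₂ _ | inj₁ refl = inj₂ (inj₁ (_ , bt))
  ... | inj₂ b<x | inj₂ x<t = inj₂ (inj₂ (_ , _ , b<x , x<t))

  spans-overlap : ∀ {b t b′ t′ x} → Spans b t x → Spans b′ t′ x → Far b t′
  spans-overlap s s′ with spans-classify s
  ... | inj₁ bot = subst (λ b → Far b _)
          (trans (sym (spans-bottom⇒≡ s′ bot)) (spans-bottom⇒≡ s bot)) (proj₁ s′)
  ... | inj₂ (inj₁ t) = subst (Far _) (trans (sym (spans-top⇒≡ s t)) (spans-top⇒≡ s′ t)) (proj₁ s)
  ... | inj₂ (inj₂ mid) = _ , proj₁ (spans-middle⇒< s mid) , proj₂ (spans-middle⇒< s′ mid)

  -- x and y lie between the ends of far pairs (b , t) and (b′ , t′) from one component of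
  -- the Far graph, which is complete bipartite by far-bipartite.
  _∼_ : Fin m → Fin m → Set
  x ∼ y = x ≡ y ⊎ ∃₂ λ b t → ∃₂ λ b′ t′ → Spans b t x × Spans b′ t′ y × Far b t′

  _∼?_ : Decidable _∼_
  x ∼? y = (x ≟ y) ⊎-dec
    any? λ b → any? λ t → any? λ b′ → any? λ t′ →
      spans? b t x ×-dec spans? b′ t′ y ×-dec far? b t′

  ∼-sym : ∀ {x y} → x ∼ y → y ∼ x
  ∼-sym (inj₁ x≡y) = inj₁ (sym x≡y)
  ∼-sym (inj₂ (_ , _ , _ , _ , sx , sy , bt′)) =
    inj₂ (_ , _ , _ , _ , sy , sx , far-bipartite (proj₁ sy) bt′ (proj₁ sx))

  ∼-trans : ∀ {x y z} → x ∼ y → y ∼ z → x ∼ z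
  ∼-trans (inj₁ refl) y∼z = y∼z
  ∼-trans x∼y@(inj₂ _) (inj₁ refl) = x∼y
  ∼-trans (inj₂ (_ , _ , _ , _ , sx , sy , bt′)) (inj₂ (_ , _ , _ , _ , sy′ , sz , cu′)) =
    inj₂ (_ , _ , _ , _ , sx , sz ,
      far-bipartite (far-bipartite bt′ (proj₁ sy) (spans-overlap sy sy′)) (proj₁ sy′) cu′)

  ∼-isEquivalence : IsEquivalence _∼_
  ∼-isEquivalence = record { refl = inj₁ refl ; sym = ∼-sym ; trans = ∼-trans }

  co-spanned⇒∼ : ∀ {b t x y} → Spans b t x → Spans b t y → x ∼ y
  co-spanned⇒∼ sx sy = inj₂ (_ , _ , _ , _ , sx , sy , proj₁ sx)

  far⇒∼ : ∀ {x y} → Far x y → x ∼ y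
  far⇒∼ far = co-spanned⇒∼ (spans-start far) (spans-end far)

  data LevelView (x : Fin m) : ℕ → Set where
    top    : Top x → LevelView x 2
    middle : ¬ Top x → Middle x → LevelView x 1
    other  : ¬ Top x → ¬ Middle x → LevelView x 0

  levelView : ∀ x → ∃ (LevelView x)
  levelView x with top? x | middle? x
  ... | yes t | _ = 2 , top t
  ... | no ¬t | yes mid = 1 , middle ¬t mid
  ... | no ¬t | no ¬mid = 0 , other ¬t ¬mid

  level : Fin m → ℕ
  level x = proj₁ (levelView x)

  level-view : ∀ x → LevelView x (level x)
  level-view x = proj₂ (levelView x)

  level≤2 : ∀ x → level x ℕ.≤ 2
  level≤2 x with level x | level-view x
  ... | _ | top _ = ℕₚ.≤-refl
  ... | _ | middle _ _ = s≤s z≤n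
  ... | _ | other _ _ = z≤n

  level-top : ∀ {x} → Top x → level x ≡ 2
  level-top {x} t with level x | level-view x
  ... | _ | top _ = refl
  ... | _ | middle ¬t _ = ⊥-elim (¬t t)
  ... | _ | other ¬t _ = ⊥-elim (¬t t)

  level-middle : ∀ {x} → Middle x → level x ≡ 1
  level-middle {x} mid with level x | level-view x
  ... | _ | top t = ⊥-elim (top-middle-disjoint t mid)
  ... | _ | middle _ _ = refl
  ... | _ | other _ ¬mid = ⊥-elim (¬mid mid)

  level-bottom : ∀ {x} → Bottom x → level x ≡ 0
  level-bottom {x} bot with level x | level-view x
  ... | _ | top t = ⊥-elim (bottom-top-disjoint bot t)
  ... | _ | middle _ mid = ⊥-elim (bottom-middle-disjoint bot mid)
  ... | _ | other _ _ = refl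

  level≡2⇒top : ∀ {x} → level x ≡ 2 → Top x
  level≡2⇒top {x} l with level x | level-view x
  ... | _ | top t = t
  ... | _ | middle _ _ = ⊥-elim (ℕₚ.1+n≢n (sym l))
  ... | _ | other _ _ = ⊥-elim (ℕₚ.0≢1+n l)

  level≡0⇒bottom : ∀ {b t x} → Spans b t x → level x ≡ 0 → Bottom x
  level≡0⇒bottom s l with spans-classify s
  ... | inj₁ bot = bot
  ... | inj₂ (inj₁ t) = ⊥-elim (ℕₚ.0≢1+n (trans (sym l) (level-top t)))
  ... | inj₂ (inj₂ mid) = ⊥-elim (ℕₚ.0≢1+n (trans (sym l) (level-middle mid)))

  middle-below-top : ∀ y → level y ≡ 2 → ∃ λ w → w ∼ y × level w ≡ 1
  middle-below-top y l with level≡2⇒top l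
  ... | b , far@(w , b<w , w<y) =
    w , co-spanned⇒∼ (far , proj₁ b<w , proj₁ w<y) (spans-end far) ,
    level-middle (_ , _ , b<w , w<y)

  bottom-below : ∀ y → 0 ℕ.< level y → ∃ λ w → w ∼ y × level w ≡ 0
  bottom-below y 0<l with level y | level-view y
  ... | _ | top (b , far) = b , far⇒∼ far , level-bottom (_ , far)
  ... | _ | middle _ (b , t , b<y , y<t) =
    b , co-spanned⇒∼ (spans-start far) (far , proj₁ b<y , proj₁ y<t) , level-bottom (_ , far)
    where
    far : Far b t
    far = y , b<y , y<t
  ... | _ | other _ _ = ⊥-elim (ℕₚ.n≮0 0<l)

  Far⇔∼∧levels : ∀ {x y} → Far x y ⇔ (x ∼ y × level x ≡ 0 × level y ≡ 2)
  Far⇔∼∧levels {x} {y} = mk⇔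
    (λ far → far⇒∼ far , level-bottom (_ , far) , level-top (_ , far))
    λ where
      (inj₁ refl , l₀ , l₂) → ⊥-elim (ℕₚ.0≢1+n (trans (sym l₀) l₂))
      (inj₂ (_ , _ , _ , _ , sx , sy , bt′) , l₀ , l₂) →
        subst₂ Far (sym (spans-bottom⇒≡ sx (level≡0⇒bottom sx l₀)))
                   (sym (spans-top⇒≡ sy (level≡2⇒top l₂))) bt′

level-gap : ∀ {a b} → a ℕ.< b → b ℕ.≤ 2 → b ≡ suc a ⊎ (a ≡ 0 × b ≡ 2)
level-gap {0} {1} _ _ = inj₁ refl
level-gap {0} {2} _ _ = inj₂ (refl , refl)
level-gap {1} {2} _ _ = inj₁ refl
level-gap {_} {0} () _
level-gap {1} {1} (s≤s ()) _
level-gap {suc (suc _)} {1} (s≤s ()) _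
level-gap {suc (suc _)} {2} (s≤s (s≤s ())) _
level-gap {_} {suc (suc (suc _))} _ (s≤s (s≤s ()))

module LevelOrder {m k : ℕ} (class : Fin m → Fin k) (level : Fin m → ℕ)
  (level≤2 : ∀ x → level x ℕ.≤ 2)
  (middle-below-top : ∀ y → level y ≡ 2 → ∃ λ w → class w ≡ class y × level w ≡ 1)
  (bottom-below : ∀ y → 0 ℕ.< level y → ∃ λ w → class w ≡ class y × level w ≡ 0) where

  _⊑_ : Fin m → Fin m → Set
  x ⊑ y = x ≡ y ⊎ (class x ≡ class y × level x ℕ.< level y)

  _⊑?_ : Decidable _⊑_
  x ⊑? y = (x ≟ y) ⊎-dec ((class x ≟ class y) ×-dec (level x ℕ.<? level y))

  ⊑-isPartialOrder : IsPartialOrder _≡_ _⊑_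
  ⊑-isPartialOrder = record
    { isPreorder = record
      { isEquivalence = isEquivalence
      ; reflexive = inj₁
      ; trans = ⊑-trans }
    ; antisym = ⊑-antisym }
    where
    ⊑-trans : ∀ {x y z} → x ⊑ y → y ⊑ z → x ⊑ z
    ⊑-trans (inj₁ refl) y⊑z = y⊑z
    ⊑-trans x⊑y (inj₁ refl) = x⊑y
    ⊑-trans (inj₂ (cxy , lxy)) (inj₂ (cyz , lyz)) = inj₂ (trans cxy cyz , ℕₚ.<-trans lxy lyz)
    ⊑-antisym : ∀ {x y} → x ⊑ y → y ⊑ x → x ≡ y
    ⊑-antisym (inj₁ x≡y) _ = x≡y
    ⊑-antisym (inj₂ _) (inj₁ y≡x) = sym y≡x
    ⊑-antisym (inj₂ (_ , lxy)) (inj₂ (_ , lyx)) = ⊥-elim (ℕₚ.<-asym lxy lyx)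

  ⊑⇒same-class : ∀ {x y} → x ⊑ y → class x ≡ class y
  ⊑⇒same-class (inj₁ refl) = refl
  ⊑⇒same-class (inj₂ (cxy , _)) = cxy

  open FinitePoset _⊑?_ ⊑-isPartialOrder public
    using () renaming (_<_ to _⊏_; Far to Far⊑)

  ⊏⇔ : ∀ {x y} → x ⊏ y ⇔ (class x ≡ class y × level x ℕ.< level y)
  ⊏⇔ = mk⇔
    (λ where (inj₁ x≡y , x≢y) → ⊥-elim (x≢y x≡y)
             (inj₂ lt , _) → lt)
    (λ lt → inj₂ lt , λ { refl → ℕₚ.<-irrefl refl (proj₂ lt) })

  Far⊑⇔ : ∀ {x y} → Far⊑ x y ⇔ (class x ≡ class y × level x ≡ 0 × level y ≡ 2)
  Far⊑⇔ {x} {y} = mk⇔ far⇒levels levels⇒far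
    where
    far⇒levels : Far⊑ x y → class x ≡ class y × level x ≡ 0 × level y ≡ 2
    far⇒levels (w , x⊏w , w⊏y) with Equivalence.to ⊏⇔ x⊏w | Equivalence.to ⊏⇔ w⊏y
    ... | cxw , lxw | cwy , lwy with level-gap (ℕₚ.<-trans lxw lwy) (level≤2 y)
    ...   | inj₂ (l₀ , l₂) = trans cxw cwy , l₀ , l₂
    ...   | inj₁ ly≡1+lx = ⊥-elim (ℕₚ.<⇒≱ lwy (subst (ℕ._≤ level w) (sym ly≡1+lx) lxw))
    levels⇒far : class x ≡ class y × level x ≡ 0 × level y ≡ 2 → Far⊑ x y
    levels⇒far (cxy , l₀ , l₂) with middle-below-top y l₂
    ... | w , cwy , l₁ =
      w , Equivalence.from ⊏⇔ (trans cxy (sym cwy) , subst₂ ℕ._<_ (sym l₀) (sym l₁) (s≤s z≤n))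
        , Equivalence.from ⊏⇔ (cwy , subst₂ ℕ._<_ (sym l₁) (sym l₂) (s≤s (s≤s z≤n)))

  rank : Fin m → ℤ
  rank x = ℤ.+ level x

  rank-suc : ∀ {x y} → level y ≡ suc (level x) → rank y ≡ rank x ℤ.+ ℤ.+ 1
  rank-suc {x} ly = cong ℤ.+_ (trans ly (ℕₚ.+-comm 1 (level x)))

  rank-isRankFunction : IsRankFunction _⊑_ rank
  rank-isRankFunction = minimal⇒rank≡0 , covers⇒rank-suc
    where
    minimal⇒rank≡0 : ∀ x → Minimal _⊑_ x → rank x ≡ ℤ.+ 0
    minimal⇒rank≡0 x minimal with level x ℕₚ.≟ 0
    ... | yes l₀ = cong ℤ.+_ l₀
    ... | no l≢0 with bottom-below x (ℕₚ.n≢0⇒n>0 l≢0)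
    ...   | w , cwx , l₀ = ⊥-elim (l≢0 (subst (λ v → level v ≡ 0) (minimal w w⊑x) l₀))
      where
      w⊑x : w ⊑ x
      w⊑x = inj₂ (cwx , subst (ℕ._< level x) (sym l₀) (ℕₚ.n≢0⇒n>0 l≢0))
    covers⇒rank-suc : ∀ x y → Covers _⊑_ x y → rank y ≡ rank x ℤ.+ ℤ.+ 1
    covers⇒rank-suc x y (x⊏y , nothing-between)
      with Equivalence.to ⊏⇔ x⊏y
    ... | cxy , lxy with level-gap lxy (level≤2 y)
    ...   | inj₁ ly = rank-suc ly
    ...   | inj₂ levels =
      ⊥-elim (nothing-between _ (proj₂ (Equivalence.from Far⊑⇔ (cxy , levels))))

  rank-complete : ∀ {x y} → class x ≡ class y → rank y ≡ rank x ℤ.+ ℤ.+ 1 → Covers _⊑_ x y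
  rank-complete {x} {y} cxy ry =
    Equivalence.from ⊏⇔ (cxy , subst (level x ℕ.<_) (sym ly) ℕₚ.≤-refl) , λ w (x⊏w , w⊏y) → let (_ , l₀ , l₂) = Equivalence.to Far⊑⇔ (w , x⊏w , w⊏y)
                         in ℕₚ.1+n≢n (trans (sym l₂) (trans ly (cong suc l₀)))
    where
    ly : level y ≡ suc (level x)
    ly = trans (ℤₚ.+-injective ry) (ℕₚ.+-comm (level x) 1)

  rank≤2 : ∀ x → rank x ℤ.≤ ℤ.+ 2
  rank≤2 x = ℤ.+≤+ (level≤2 x)

module Fibres {m k : ℕ} {_⊑_ : Fin m → Fin m → Set}
              (_⊑?_ : Decidable _⊑_) (isPO : IsPartialOrder _≡_ _⊑_)
              (class : Fin m → Fin k) (⊑⇒same-class : ∀ {x y} → x ⊑ y → class x ≡ class y) where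

  open IsPartialOrder isPO using (antisym)

  Fibre : Fin k → Set
  Fibre i = Σ (Fin m) λ x → class x ≡ i

  class-irrelevant : ∀ {x i} → Irrelevant (class x ≡ i)
  class-irrelevant = Decidable⇒UIP.≡-irrelevant _≟_

  fibre-≡ : ∀ {i} (p q : Fibre i) → proj₁ p ≡ proj₁ q → p ≡ q
  fibre-≡ (x , p) (.x , q) refl = cong (x ,_) (class-irrelevant p q)

  fibre↔ : ∀ i → ∃ λ s → Fibre i ↔ Fin s
  fibre↔ i = Σ-Fin↔Fin (λ x → class x ≟ i) class-irrelevant

  size : Fin k → ℕ
  size i = proj₁ (fibre↔ i)

  module _ {i : Fin k} where
    open Inverse (proj₂ (fibre↔ i)) public
      using () renaming (to to index; from to member′; strictlyInverseˡ to index-member′)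
    open Inverse (proj₂ (fibre↔ i)) using (strictlyInverseʳ)

    member : Fin (size i) → Fin m
    member a = proj₁ (member′ a)

    member-class : ∀ a → class (member a) ≡ i
    member-class a = proj₂ (member′ a)

    member-index : ∀ {x} (cx : class x ≡ i) → member (index (x , cx)) ≡ x
    member-index {x} cx = cong proj₁ (strictlyInverseʳ (x , cx))

    member-injective : ∀ {a b} → member a ≡ member b → a ≡ b
    member-injective {a} {b} eq = begin
      a                   ≡⟨ sym (index-member′ a) ⟩
      index (member′ a)   ≡⟨ cong index (fibre-≡ (member′ a) (member′ b) eq) ⟩
      index (member′ b)   ≡⟨ index-member′ b ⟩
      b                   ∎
      where open ≡-Reasoning

  summand : ∀ i → FinPoset (size i)
  summand i = record
    { _≼_ = λ a b → member a ⊑ member b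
    ; dec = λ a b → member a ⊑? member b
    ; isPO = record
      { isPreorder = record
        { isEquivalence = isEquivalence
        ; reflexive = λ { refl → IsPartialOrder.refl isPO }
        ; trans = IsPartialOrder.trans isPO }
      ; antisym = λ a⊑b b⊑a → member-injective (antisym a⊑b b⊑a) } }

  split : Fin m ↔ Σ (Fin k) (Fin ∘ size)
  split = mk↔ₛ′ (λ x → class x , index (x , refl)) (λ (i , a) → member a)
    (λ (i , a) → trans (split-fibre (member′ a)) (cong (i ,_) (index-member′ a)))
    (λ x → member-index refl)
    where
    split-fibre : ∀ {i} (p : Fibre i) → (class (proj₁ p) , index (proj₁ p , refl)) ≡ (i , index p)
    split-fibre (x , refl) = refl

  ⊑⇔SumLe : ∀ {x y} → x ⊑ y ⇔ SumLe size summand (Inverse.to split x) (Inverse.to split y)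
  ⊑⇔SumLe {x} {y} = mk⇔
    (λ x⊑y → inSummand′ (⊑⇒same-class x⊑y)
               (subst₂ _⊑_ (sym (member-index refl)) (sym (member-index refl)) x⊑y))
    (λ s → subst₂ _⊑_ (member-index refl) (member-index refl) (SumLe⇒⊑ s))
    where
    SumLe⇒⊑ : ∀ {p q} → SumLe size summand p q → Inverse.from split p ⊑ Inverse.from split q
    SumLe⇒⊑ (inSummand a⊑b) = a⊑b
    inSummand′ : ∀ {i j a b} → i ≡ j → member {i} a ⊑ member {j} b →
                 SumLe size summand (i , a) (j , b)
    inSummand′ refl = inSummand

  module _ {i : Fin k} where
    private
      _⊑ᵢ_ : Fin (size i) → Fin (size i) → Set
      _⊑ᵢ_ = FinPoset._≼_ (summand i)

    in-fibre : ∀ {w} → class w ≡ i → ∃ λ a → member a ≡ w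
    in-fibre cw = index (_ , cw) , member-index cw

    Strict-member⇔ : ∀ {a b} → Strict _⊑ᵢ_ a b ⇔ Strict _⊑_ (member a) (member b)
    Strict-member⇔ = mk⇔ (λ (a⊑b , a≢b) → a⊑b , a≢b ∘ member-injective)
                         (λ (a⊑b , a≢b) → a⊑b , a≢b ∘ cong member)

    Covers-member⇔ : ∀ {a b} → Covers _⊑ᵢ_ a b ⇔ Covers _⊑_ (member a) (member b)
    Covers-member⇔ {a} {b} = mk⇔
      (λ (a<b , nothing-between) → Equivalence.to Strict-member⇔ a<b , λ w (a<w , w<b) →
        let (c , c≡w) = in-fibre (trans (⊑⇒same-class (proj₁ w<b)) (member-class b))
        in nothing-between c
             ( Equivalence.from Strict-member⇔ (subst (Strict _⊑_ (member a)) (sym c≡w) a<w)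
             , Equivalence.from Strict-member⇔
                 (subst (λ v → Strict _⊑_ v (member b)) (sym c≡w) w<b)))
      (λ (a<b , nothing-between) → Equivalence.from Strict-member⇔ a<b , λ c (a<c , c<b) →
        nothing-between (member c)
          (Equivalence.to Strict-member⇔ a<c , Equivalence.to Strict-member⇔ c<b))

    Minimal-member : ∀ {a} → Minimal _⊑ᵢ_ a → Minimal _⊑_ (member a)
    Minimal-member {a} minimal w w⊑a =
      let (c , c≡w) = in-fibre (trans (⊑⇒same-class w⊑a) (member-class a))
      in trans (sym c≡w) (cong member (minimal c (subst (_⊑ member a) (sym c≡w) w⊑a)))

  summand-completelyRanked : (ρ : Fin m → ℤ) → IsRankFunction _⊑_ ρ →
    (∀ {x y} → class x ≡ class y → ρ y ≡ ρ x ℤ.+ ℤ.+ 1 → Covers _⊑_ x y) →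
    (∀ x → ρ x ℤ.≤ ℤ.+ 2) →
    ∀ i → CompletelyRankedRankAtMost2 (FinPoset._≼_ (summand i))
  summand-completelyRanked ρ (minimal⇒0 , covers⇒suc) complete ρ≤2 i =
    ρ ∘ member ,
    ( (λ a minimal → minimal⇒0 (member a) (Minimal-member minimal))
    , (λ a b a⊲b → covers⇒suc (member a) (member b) (Equivalence.to Covers-member⇔ a⊲b)) ) ,
    (λ a b ρ-suc → Equivalence.from Covers-member⇔
                     (complete (trans (member-class a) (sym (member-class b))) ρ-suc)) ,
    ρ≤2 ∘ member

module Decomposition {m : ℕ} (P : FinPoset m)
                     (p4free : InducedP4Free (CIEdge (FinPoset._≼_ P))) where

  open FinPoset P using (_≼_; dec; isPO)
  open CographPoset dec isPO p4free
    using (_∼?_; ∼-isEquivalence; level; level≤2; middle-below-top; bottom-below; Far⇔∼∧levels)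
  open CanonicalRepresentative ∼-isEquivalence _∼?_ using (rep; rep-≡⇔∼)

  middle-in-class : ∀ y → level y ≡ 2 → ∃ λ w → rep w ≡ rep y × level w ≡ 1
  middle-in-class y l =
    let (w , w∼y , l₁) = middle-below-top y l in w , Equivalence.from rep-≡⇔∼ w∼y , l₁

  bottom-in-class : ∀ y → 0 ℕ.< level y → ∃ λ w → rep w ≡ rep y × level w ≡ 0
  bottom-in-class y l =
    let (w , w∼y , l₀) = bottom-below y l in w , Equivalence.from rep-≡⇔∼ w∼y , l₀

  open LevelOrder rep level level≤2 middle-in-class bottom-in-class
  open Fibres _⊑?_ ⊑-isPartialOrder rep ⊑⇒same-class
    public using (size; summand; split; ⊑⇔SumLe; summand-completelyRanked)

  summands-completelyRanked : ∀ i → CompletelyRankedRankAtMost2 (FinPoset._≼_ (summand i))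
  summands-completelyRanked = summand-completelyRanked rank rank-isRankFunction rank-complete rank≤2

  Far⇔Far⊑ : ∀ {x y} → FinitePoset.Far dec isPO x y ⇔ Far⊑ x y
  Far⇔Far⊑ = mk⇔
    (λ far → let (x∼y , l₀ , l₂) = Equivalence.to Far⇔∼∧levels far
             in Equivalence.from Far⊑⇔ (Equivalence.from rep-≡⇔∼ x∼y , l₀ , l₂))
    (λ far → let (same , l₀ , l₂) = Equivalence.to Far⊑⇔ far
             in Equivalence.from Far⇔∼∧levels (Equivalence.to rep-≡⇔∼ same , l₀ , l₂))

  CIEdge⇔SumLe : ∀ x y →
    CIEdge _≼_ x y ⇔ CIEdge (SumLe size summand) (Inverse.to split x) (Inverse.to split y)
  CIEdge⇔SumLe x y = OrderIsomorphism.CIEdge⇔ _⊑_ (SumLe size summand) split ⊑⇔SumLe {x} {y}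
    ⇔-∘ CIEdge⇔-from-Far⇔ dec isPO _⊑?_ ⊑-isPartialOrder Far⇔Far⊑ {x} {y}

lemma4p5 : (n : ℕ) (G : SimpleGraph n) → IsCograph G → IsCIGraph G →
    Σ ℕ λ r → Σ (Fin r → ℕ) λ s → Σ ((i : Fin r) → FinPoset (s i)) λ P →
      ((i : Fin r) → CompletelyRankedRankAtMost2 (FinPoset._≼_ (P i))) ×
      (G ≅ CIEdge (SumLe s P))
lemma4p5 n G cograph (m , P , φ , G⇔G[P]) =
  m , size , summand , summands-completelyRanked ,
  ≅-transport {E = G[P]} {F = CIEdge (SumLe size summand)} {G = G} (φ , G⇔G[P]) (↔⇒⤖ split)
    CIEdge⇔SumLe
  where
  G[P] : Fin m → Fin m → Set
  G[P] = CIEdge (FinPoset._≼_ P)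
  G[P]-p4free : InducedP4Free G[P]
  G[P]-p4free = inducedP4Free-transport (⤖⇒↔ φ) G⇔G[P] cograph
  open Decomposition P G[P]-p4free
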